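{- Let $N\ge 2$ be an even integer and let $A_1,A_2,\ldots$ be a quasifibonacci sequence of level $N$. Write the formal power series \[H(x)=\prod_{k\ge 1}\bigl(1-x^{A_k}\bigr)=1+\sum_{m\ge 1}h_m x^m .\] Then $h_m\in\{ -1,0,1\}$ for every $m\ge 1$.
   Context: For an integer $N\ge 2$, a sequence $A_1,A_2,\ldots$ of positive integers is a quasifibonacci sequence of level $N$ if $A_{k+N}=A_{k+N-1}+A_{k+N-2}+\cdots+A_k$ for all $k\ge 1$, and $A_k>A_{k-1}+\cdots+A_1$ for all $1\le k\le N$. -}

module Defs where

open import Data.Nat using (ℕ; zero; suc; _+_; _∸_; _≤_; _<_; _≤?_)
open import Data.Integer as ℤ using (ℤ)
open import Relation.Nullary using (yes; no)
open import Relation.Binary.PropositionalEquality using (_≡_)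

-- Sequences are indexed from 1: A : ℕ → ℕ, with the value A 0 unused.

sumFrom1 : (ℕ → ℕ) → ℕ → ℕ
sumFrom1 A zero    = 0
sumFrom1 A (suc n) = sumFrom1 A n + A (suc n)

window : (ℕ → ℕ) → ℕ → ℕ → ℕ
window A k zero    = 0
window A k (suc n) = A k + window A (suc k) n

record Quasifibonacci (N : ℕ) (A : ℕ → ℕ) : Set where
  field
    positive   : ∀ k → 1 ≤ k → 1 ≤ A k
    recurrence : ∀ k → 1 ≤ k → A (k + N) ≡ window A k N
    initial    : ∀ k → 1 ≤ k → k ≤ N → sumFrom1 A (k ∸ 1) < A k

-- Coefficients (as a function ℕ → ℤ) of the polynomial ∏_{k=1}^{n} (1 - x^{A k}).
prodCoeff : (ℕ → ℕ) → ℕ → ℕ → ℤ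
prodCoeff A zero    zero    = ℤ.+ 1
prodCoeff A zero    (suc j) = ℤ.+ 0
prodCoeff A (suc n) j with A (suc n) ≤? j
... | yes _ = prodCoeff A n j ℤ.- prodCoeff A n (j ∸ A (suc n))
... | no  _ = prodCoeff A n j

-- For a quasifibonacci sequence, A is strictly increasing with A k ≥ k ≥ 1, so factors
-- with k > m do not affect the coefficient of x^m; hence h_m is the coefficient of x^m
-- in the finite product over k = 1..m.
hCoeff : (ℕ → ℕ) → ℕ → ℤ
hCoeff A m = prodCoeff A m m

{-# OPTIONS --safe #-}
-- Let P n = ∏_{k ≤ n} (1 - x^{A k}) and S n = A 1 + ⋯ + A n. The polynomial P n is palindromic up
-- to the sign (-1)^n, and the growth of A forces S m < A (m + 2), so the coefficients of x^j with
-- j ≤ S m are already final in P (m + 1). For n = N + m the recurrence reads S n = S m + A (n + 1);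
-- reflecting P n and P (m + 1), whose signs are opposite because N is even, turns the coefficient of
-- x^(A (n + 1) + i) in P (n + 1) into [x^(i - A (m + 1))] P m - [x^(A (m + 1) + i)] P m, and as
-- S m < 2 A (m + 1) at most one of these two terms is nonzero. In all other cases one of the two
-- terms of P (n + 1) = P n - x^(A (n + 1)) P n vanishes at the exponent considered, so induction on n
-- keeps every coefficient in {-1, 0, 1}.
module Submission where

open import Defs
open import Data.Empty using (⊥-elim)
open import Data.Integer as ℤ
  using (ℤ; +_; -[1+_]; 0ℤ; 1ℤ; -1ℤ; _-_; -_; _*_; _^_; +<+; -<+)
import Data.Integer.Properties as ℤP
open import Data.Integer.Tactic.RingSolver using (solve-∀)
open import Data.Nat as ℕ using (ℕ; zero; suc; _+_; _∸_; _≤_; _<_; _≤?_; _<?_; z≤n; s≤s)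
open import Data.Nat.Divisibility using (_∣_; divides)
open import Data.Nat.Induction using (<-rec)
open import Data.Nat.Properties
open import Data.Product using (_,_)
open import Data.Sum using (_⊎_; inj₁; inj₂)
open import Relation.Binary.PropositionalEquality
open import Relation.Nullary using (yes; no)

a+b≤c+d⇒c<b⇒a<d : ∀ {a b c d} → a + b ≤ c + d → c < b → a < d
a+b≤c+d⇒c<b⇒a<d {a} {b} {c} {d} a+b≤c+d c<b =
  +-cancelʳ-< b a d (≤-<-trans a+b≤c+d (subst (c + d <_) (+-comm b d) (+-monoˡ-< d c<b)))

sumFrom1-+≡+window : ∀ A m r → sumFrom1 A (m + r) ≡ sumFrom1 A m + window A (suc m) r
sumFrom1-+≡+window A m zero = trans (cong (sumFrom1 A) (+-identityʳ m)) (sym (+-identityʳ _))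
sumFrom1-+≡+window A m (suc r) = begin
  sumFrom1 A (m + suc r)                              ≡⟨ cong (sumFrom1 A) (+-suc m r) ⟩
  sumFrom1 A (suc m + r)                              ≡⟨ sumFrom1-+≡+window A (suc m) r ⟩
  sumFrom1 A m + A (suc m) + window A (suc (suc m)) r ≡⟨ +-assoc (sumFrom1 A m) _ _ ⟩
  sumFrom1 A m + window A (suc m) (suc r)             ∎
  where open ≡-Reasoning

sumFrom1-mono-≤ : ∀ A {m n} → m ≤ n → sumFrom1 A m ≤ sumFrom1 A n
sumFrom1-mono-≤ A {m} m≤n with m≤n⇒∃[o]m+o≡n m≤n
... | d , refl = subst (sumFrom1 A m ≤_) (sym (sumFrom1-+≡+window A m d)) (m≤m+n _ _)

-1^n*-1^n≡1 : ∀ n → -1ℤ ^ n * -1ℤ ^ n ≡ 1ℤ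
-1^n*-1^n≡1 zero    = refl
-1^n*-1^n≡1 (suc n) = trans (-x*-x≡x*x (-1ℤ ^ n)) (-1^n*-1^n≡1 n)
  where
  -x*-x≡x*x : ∀ x → -1ℤ * x * (-1ℤ * x) ≡ x * x
  -x*-x≡x*x = solve-∀

-1^[k*2+m]≡-1^m : ∀ k m → -1ℤ ^ (k ℕ.* 2 + m) ≡ -1ℤ ^ m
-1^[k*2+m]≡-1^m zero    m = refl
-1^[k*2+m]≡-1^m (suc k) m = trans (-1*[-1*x]≡x (-1ℤ ^ (k ℕ.* 2 + m))) (-1^[k*2+m]≡-1^m k m)
  where
  -1*[-1*x]≡x : ∀ x → -1ℤ * (-1ℤ * x) ≡ x
  -1*[-1*x]≡x = solve-∀

-1^[k*2+m]*-1^[1+m]≡-1 : ∀ k m → -1ℤ ^ (k ℕ.* 2 + m) * -1ℤ ^ suc m ≡ -1ℤ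
-1^[k*2+m]*-1^[1+m]≡-1 k m = begin
  -1ℤ ^ (k ℕ.* 2 + m) * (-1ℤ * -1ℤ ^ m) ≡⟨ cong (_* (-1ℤ * -1ℤ ^ m)) (-1^[k*2+m]≡-1^m k m) ⟩
  -1ℤ ^ m * (-1ℤ * -1ℤ ^ m)             ≡⟨ x*[-x]≡-[x*x] (-1ℤ ^ m) ⟩
  -1ℤ * (-1ℤ ^ m * -1ℤ ^ m)             ≡⟨ cong (-1ℤ *_) (-1^n*-1^n≡1 m) ⟩
  -1ℤ                                   ∎
  where
  open ≡-Reasoning
  x*[-x]≡-[x*x] : ∀ x → x * (-1ℤ * x) ≡ -1ℤ * (x * x)
  x*[-x]≡-[x*x] = solve-∀

UnitOrZero : ℤ → Set
UnitOrZero z = z ≡ -1ℤ ⊎ z ≡ 0ℤ ⊎ z ≡ 1ℤ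

UnitOrZero-difference : ∀ {x y} → x ≡ 0ℤ ⊎ y ≡ 0ℤ → UnitOrZero x → UnitOrZero y → UnitOrZero (x - y)
UnitOrZero-difference (inj₁ refl) _ (inj₁ refl)        = inj₂ (inj₂ refl)
UnitOrZero-difference (inj₁ refl) _ (inj₂ (inj₁ refl)) = inj₂ (inj₁ refl)
UnitOrZero-difference (inj₁ refl) _ (inj₂ (inj₂ refl)) = inj₁ refl
UnitOrZero-difference (inj₂ refl) x∈ _                 = subst UnitOrZero (sym (ℤP.+-identityʳ _)) x∈

module Coefficients (A : ℕ → ℕ) where

  S : ℕ → ℕ
  S = sumFrom1 A

  -- Exponents range over ℤ so that the reflection j ↦ S n - j is total.
  coeff : ℕ → ℤ → ℤ
  coeff zero    (+ zero)  = 1ℤ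
  coeff zero    (+ suc _) = 0ℤ
  coeff zero    -[1+ _ ]  = 0ℤ
  coeff (suc n) j         = coeff n j - coeff n (j - + A (suc n))

  coeff-negative : ∀ n {j} → j ℤ.< 0ℤ → coeff n j ≡ 0ℤ
  coeff-negative zero    { -[1+ _ ]} _ = refl
  coeff-negative zero    {+ _} (+<+ ())
  coeff-negative (suc n) {j} j<0
    rewrite coeff-negative n j<0
          | coeff-negative n (ℤP.≤-<-trans (ℤP.i-j≤i j (+ A (suc n))) j<0) = refl

  coeff-below : ∀ n {j k} → j ℤ.< k → coeff n (j - k) ≡ 0ℤ
  coeff-below n {j} {k} j<k =
    coeff-negative n (subst (j - k ℤ.<_) (ℤP.+-inverseʳ k) (ℤP.+-monoˡ-< (- k) j<k))

  coeff-suc-below : ∀ n {j} → j ℤ.< + A (suc n) → coeff (suc n) j ≡ coeff n j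
  coeff-suc-below n {j} j<a = trans (cong (λ x → coeff n j - x) (coeff-below n j<a)) (ℤP.+-identityʳ _)

  coeff-suc-shift : ∀ n i → coeff (suc n) (+ (A (suc n) + i)) ≡ coeff n (+ (A (suc n) + i)) - coeff n (+ i)
  coeff-suc-shift n i = cong (λ j → coeff n (+ (A (suc n) + i)) - coeff n j) (a+i-a≡i (+ A (suc n)) (+ i))
    where
    a+i-a≡i : ∀ a i → a ℤ.+ i - a ≡ i
    a+i-a≡i = solve-∀

  coeff-palindromic : ∀ n j → coeff n (+ S n - j) ≡ -1ℤ ^ n * coeff n j
  coeff-palindromic zero (+ zero)  = refl
  coeff-palindromic zero (+ suc _) = refl
  coeff-palindromic zero -[1+ _ ]  = refl
  coeff-palindromic (suc n) j = begin
    coeff n (s ℤ.+ a - j) - coeff n (s ℤ.+ a - j - a)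
      ≡⟨ cong₂ (λ u v → coeff n u - coeff n v) (s+a-j≡s-[j-a] s a j) (s+a-j-a≡s-j s a j) ⟩
    coeff n (s - (j - a)) - coeff n (s - j)
      ≡⟨ cong₂ _-_ (coeff-palindromic n (j - a)) (coeff-palindromic n j) ⟩
    ε * coeff n (j - a) - ε * coeff n j
      ≡⟨ ε*y-ε*x≡-ε*[x-y] ε (coeff n j) (coeff n (j - a)) ⟩
    -1ℤ * ε * (coeff n j - coeff n (j - a))
      ∎
    where
    open ≡-Reasoning
    s = + S n
    a = + A (suc n)
    ε = -1ℤ ^ n
    s+a-j≡s-[j-a] : ∀ s a j → s ℤ.+ a - j ≡ s - (j - a)
    s+a-j≡s-[j-a] = solve-∀
    s+a-j-a≡s-j : ∀ s a j → s ℤ.+ a - j - a ≡ s - j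
    s+a-j-a≡s-j = solve-∀
    ε*y-ε*x≡-ε*[x-y] : ∀ ε x y → ε * y - ε * x ≡ -1ℤ * ε * (x - y)
    ε*y-ε*x≡-ε*[x-y] = solve-∀

  coeff-reflect : ∀ n j → coeff n j ≡ -1ℤ ^ n * coeff n (+ S n - j)
  coeff-reflect n j = trans (cong (coeff n) (sym (s-[s-j]≡j (+ S n) j))) (coeff-palindromic n (+ S n - j))
    where
    s-[s-j]≡j : ∀ s j → s - (s - j) ≡ j
    s-[s-j]≡j = solve-∀

  coeff-above : ∀ n {i} → S n < i → coeff n (+ i) ≡ 0ℤ
  coeff-above n {i} Sn<i = begin
    coeff n (+ i)                      ≡⟨ coeff-reflect n (+ i) ⟩
    -1ℤ ^ n * coeff n (+ S n - + i)    ≡⟨ cong (-1ℤ ^ n *_) (coeff-below n (+<+ Sn<i)) ⟩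
    -1ℤ ^ n * 0ℤ                       ≡⟨ ℤP.*-zeroʳ (-1ℤ ^ n) ⟩
    0ℤ                                 ∎
    where open ≡-Reasoning

  prodCoeff≡coeff : ∀ n i → prodCoeff A n i ≡ coeff n (+ i)
  prodCoeff≡coeff zero    zero    = refl
  prodCoeff≡coeff zero    (suc i) = refl
  prodCoeff≡coeff (suc n) i with A (suc n) ≤? i
  ... | yes a≤i = cong₂ _-_ (prodCoeff≡coeff n i)
                    (trans (prodCoeff≡coeff n (i ∸ A (suc n)))
                           (cong (coeff n) (sym (trans (ℤP.m-n≡m⊖n i (A (suc n))) (ℤP.⊖-≥ a≤i)))))
  ... | no a≰i  = trans (prodCoeff≡coeff n i) (sym (coeff-suc-below n (+<+ (≰⇒> a≰i))))

module QuasifibonacciProperties {r : ℕ} {A : ℕ → ℕ} (Qf : Quasifibonacci (2 + r) A) where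

  open Quasifibonacci Qf
  open Coefficients A

  N : ℕ
  N = 2 + r

  initial-sum<A : ∀ {n} → n < N → S n < A (suc n)
  initial-sum<A {n} n<N = initial (suc n) (s≤s z≤n) n<N

  sum-recurrence : ∀ t → S (N + t) ≡ S t + A (suc (N + t))
  sum-recurrence t = begin
    S (N + t)                ≡⟨ cong S (+-comm N t) ⟩
    S (t + N)                ≡⟨ sumFrom1-+≡+window A t N ⟩
    S t + window A (suc t) N ≡⟨ cong (λ x → S t + x) (sym (recurrence (suc t) (s≤s z≤n))) ⟩
    S t + A (suc (t + N))    ≡⟨ cong (λ n → S t + A (suc n)) (+-comm t N) ⟩
    S t + A (suc (N + t))    ∎
    where open ≡-Reasoning

  sum<A[N+] : ∀ t → S t < A (N + t)
  sum<A[N+] zero    = subst (λ n → 0 < A n) (sym (+-identityʳ N)) (positive N (s≤s z≤n))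
  sum<A[N+] (suc t) = subst (λ n → S (suc t) < A n) (sym (+-suc N t))
    (a+b≤c+d⇒c<b⇒a<d (≤-trans S[1+t]+A[N+t]≤S[N+t] (≤-reflexive (sum-recurrence t))) (sum<A[N+] t))
    where
    -- S (N + t) = S (1 + r + t) + A (N + t) holds by computation.
    S[1+t]+A[N+t]≤S[N+t] : S (suc t) + A (N + t) ≤ S (N + t)
    S[1+t]+A[N+t]≤S[N+t] = +-monoˡ-≤ (A (N + t)) (sumFrom1-mono-≤ A (s≤s (m≤n+m t r)))

  sum<A[2+] : ∀ k → S k < A (2 + k)
  sum<A[2+] k with 2 + k ≤? N
  ... | yes 2+k≤N = ≤-<-trans (m≤m+n (S k) (A (suc k))) (initial-sum<A 2+k≤N)
  ... | no 2+k≰N with m≤n⇒∃[o]m+o≡n (≤-pred (≰⇒> 2+k≰N))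
  ...   | t , refl = a+b≤c+d⇒c<b⇒a<d (≤-reflexive (sum-recurrence t)) (sum<A[N+] t)

  sum<A : ∀ {m k} → m < k → S m < A (suc k)
  sum<A {k = suc k} (s≤s m≤k) = ≤-<-trans (sumFrom1-mono-≤ A m≤k) (sum<A[2+] k)

  sum<2A : ∀ m → S m < A (suc m) + A (suc m)
  sum<2A m with suc m ≤? N
  ... | yes m<N = <-≤-trans (initial-sum<A m<N) (m≤m+n _ _)
  ... | no m≮N with m≤n⇒∃[o]m+o≡n (≮⇒≥ m≮N)
  ...   | t , refl = subst (_< A (suc m) + A (suc m)) (sym (sum-recurrence t))
                       (+-monoˡ-< (A (suc m)) (sum<A (m<n+m t (s≤s z≤n))))

  coeff-stable : ∀ {m n i} → i ≤ S m → m < n → coeff n (+ i) ≡ coeff (suc m) (+ i)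
  coeff-stable {m} {suc n} i≤Sm (s≤s m≤n) with m≤n⇒m<n∨m≡n m≤n
  ... | inj₂ refl = refl
  ... | inj₁ m<n  = trans (coeff-suc-below n (+<+ (≤-<-trans i≤Sm (sum<A m<n)))) (coeff-stable i≤Sm m<n)

  module _ (k : ℕ) (N≡k*2 : N ≡ k ℕ.* 2) where

    coeff-reflect-past-level : ∀ m {i s} → i + s ≡ S m →
      coeff (N + m) (+ (A (suc (N + m)) + i)) ≡ -1ℤ * coeff (suc m) (+ (A (suc m) + i))
    coeff-reflect-past-level m {i} {s} i+s≡Sm = begin
      coeff n (+ (a + i))
        ≡⟨ coeff-reflect n (+ (a + i)) ⟩
      -1ℤ ^ n * coeff n (+ S n - + (a + i))
        ≡⟨ cong (λ j → -1ℤ ^ n * coeff n j) (reflected-exponent a (sum-recurrence m)) ⟩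
      -1ℤ ^ n * coeff n (+ s)
        ≡⟨ cong (-1ℤ ^ n *_) (coeff-stable s≤Sm (m<n+m m {N} (s≤s z≤n))) ⟩
      -1ℤ ^ n * coeff (suc m) (+ s)
        ≡⟨ cong (λ j → -1ℤ ^ n * coeff (suc m) j) (sym (reflected-exponent b refl)) ⟩
      -1ℤ ^ n * coeff (suc m) (+ S (suc m) - + (b + i))
        ≡⟨ cong (-1ℤ ^ n *_) (coeff-palindromic (suc m) (+ (b + i))) ⟩
      -1ℤ ^ n * (-1ℤ ^ suc m * c)
        ≡⟨ sym (ℤP.*-assoc (-1ℤ ^ n) _ c) ⟩
      -1ℤ ^ n * -1ℤ ^ suc m * c
        ≡⟨ cong (_* c) signs ⟩
      -1ℤ * c
        ∎
      where
      open ≡-Reasoning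
      n = N + m
      a = A (suc n)
      b = A (suc m)
      c = coeff (suc m) (+ (b + i))
      s≤Sm : s ≤ S m
      s≤Sm = subst (s ≤_) i+s≡Sm (m≤n+m s i)
      i+s+a-[a+i]≡s : ∀ i s a → i ℤ.+ s ℤ.+ a - (a ℤ.+ i) ≡ s
      i+s+a-[a+i]≡s = solve-∀
      reflected-exponent : ∀ {t} x → S t ≡ S m + x → + S t - + (x + i) ≡ + s
      reflected-exponent x St≡Sm+x =
        trans (cong (λ t → + t - + (x + i)) (trans St≡Sm+x (cong (_+ x) (sym i+s≡Sm))))
              (i+s+a-[a+i]≡s (+ i) (+ s) (+ x))
      signs : -1ℤ ^ n * -1ℤ ^ suc m ≡ -1ℤ
      signs = trans (cong (λ l → -1ℤ ^ (l + m) * -1ℤ ^ suc m) N≡k*2) (-1^[k*2+m]*-1^[1+m]≡-1 k m)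

    coeff-past-level : ∀ m {i} → i ≤ S m →
      coeff (suc (N + m)) (+ (A (suc (N + m)) + i)) ≡ coeff m (+ i - + A (suc m)) - coeff m (+ (A (suc m) + i))
    coeff-past-level m {i} i≤Sm with m≤n⇒∃[o]m+o≡n i≤Sm
    ... | s , i+s≡Sm = begin
      coeff (suc n) (+ (A (suc n) + i))
        ≡⟨ coeff-suc-shift n i ⟩
      coeff n (+ (A (suc n) + i)) - coeff n (+ i)
        ≡⟨ cong₂ _-_ (coeff-reflect-past-level m i+s≡Sm) (coeff-stable i≤Sm (m<n+m m {N} (s≤s z≤n))) ⟩
      -1ℤ * coeff (suc m) (+ (b + i)) - coeff (suc m) (+ i)
        ≡⟨ cong (λ x → -1ℤ * x - coeff (suc m) (+ i)) (coeff-suc-shift m i) ⟩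
      -1ℤ * (coeff m (+ (b + i)) - coeff m (+ i)) - (coeff m (+ i) - coeff m (+ i - + b))
        ≡⟨ -[x-y]-[y-z]≡z-x (coeff m (+ (b + i))) (coeff m (+ i)) (coeff m (+ i - + b)) ⟩
      coeff m (+ i - + b) - coeff m (+ (b + i))
        ∎
      where
      open ≡-Reasoning
      n = N + m
      b = A (suc m)
      -[x-y]-[y-z]≡z-x : ∀ x y z → -1ℤ * (x - y) - (y - z) ≡ z - x
      -[x-y]-[y-z]≡z-x = solve-∀

    coeff-unitOrZero : ∀ n j → UnitOrZero (coeff n j)
    coeff-unitOrZero = <-rec (λ n → ∀ j → UnitOrZero (coeff n j)) step
      where
      step : ∀ n → (∀ {m} → m < n → ∀ j → UnitOrZero (coeff m j)) → ∀ j → UnitOrZero (coeff n j)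
      step zero _ (+ zero)  = inj₂ (inj₂ refl)
      step zero _ (+ suc _) = inj₂ (inj₁ refl)
      step zero _ -[1+ _ ]  = inj₂ (inj₁ refl)
      step (suc n) ih -[1+ _ ] =
        UnitOrZero-difference (inj₁ (coeff-negative n -<+)) (ih (n<1+n n) _) (ih (n<1+n n) _)
      step (suc n) ih (+ J) with J <? A (suc n) | S n <? J
      ... | yes J<a | _ =
        UnitOrZero-difference (inj₂ (coeff-below n (+<+ J<a))) (ih (n<1+n n) _) (ih (n<1+n n) _)
      ... | no _ | yes Sn<J =
        UnitOrZero-difference (inj₁ (coeff-above n Sn<J)) (ih (n<1+n n) _) (ih (n<1+n n) _)
      ... | no J≮a | no Sn≮J with n <? N
      ...   | yes n<N = ⊥-elim (J≮a (≤-<-trans (≮⇒≥ Sn≮J) (initial-sum<A n<N)))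
      ...   | no n≮N with m≤n⇒∃[o]m+o≡n (≮⇒≥ n≮N) | m≤n⇒∃[o]m+o≡n (≮⇒≥ J≮a)
      ...     | m , refl | i , refl =
        subst UnitOrZero (sym (coeff-past-level m i≤Sm))
          (UnitOrZero-difference one-vanishes (ih m<n _) (ih m<n _))
        where
        a = A (suc (N + m))
        b = A (suc m)
        m<n : m < suc (N + m)
        m<n = m<n+m m {suc N} (s≤s z≤n)
        i≤Sm : i ≤ S m
        i≤Sm = +-cancelˡ-≤ a i (S m)
          (subst (a + i ≤_) (trans (sum-recurrence m) (+-comm (S m) a)) (≮⇒≥ Sn≮J))
        one-vanishes : coeff m (+ i - + b) ≡ 0ℤ ⊎ coeff m (+ (b + i)) ≡ 0ℤ
        one-vanishes with i <? b
        ... | yes i<b = inj₁ (coeff-below m (+<+ i<b))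
        ... | no i≮b  = inj₂ (coeff-above m (<-≤-trans (sum<2A m) (+-monoʳ-≤ b (≮⇒≥ i≮b))))

theorem1p1 : (N : ℕ) → 2 ≤ N → 2 ∣ N → (A : ℕ → ℕ) → Quasifibonacci N A →
    (m : ℕ) → 1 ≤ m →
      hCoeff A m ≡ -[1+ 0 ] ⊎ hCoeff A m ≡ + 0 ⊎ hCoeff A m ≡ + 1
theorem1p1 (suc (suc r)) (s≤s (s≤s z≤n)) (divides k N≡k*2) A Qf m _ =
  subst UnitOrZero (sym (Coefficients.prodCoeff≡coeff A m m))
    (QuasifibonacciProperties.coeff-unitOrZero Qf k N≡k*2 m (+ m))
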